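{- Let $G$ be a vertex-colored graph and $T$ a colorful tree, let $H = \textsc{mcg}(G,T)$ (assume $V_H \neq \emptyset$), and let $\mathcal{G}$ be the set of graphs returned by \textsc{All-Colorful}$(H)$. Then for every subgraph $\widetilde{G}'$ of $H$: $\widetilde{G}' \in \mathcal{G}$ if and only if $\widetilde{G}'$ is color-isomorphic to $T$.
   Context: A vertex-colored graph is a finite simple undirected graph with a color function $c$ on its vertices; it is colorful if $c$ is injective on its vertices. A color-isomorphism is a graph isomorphism preserving vertex colors. Algorithm \textsc{mcg}$(G,T)$: set $H := G$; delete from $H$ every vertex whose color is not the color of some vertex of $T$; delete every edge $vv'$ for which there is no edge $ww' \in E_T$ with $c(v) = c(w)$, $c(v') = c(w')$; then, while there exist $v \in V_H$ and $w, w' \in V_T$ with $c(v) = c(w)$, $ww' \in E_T$, such that no neighbor $v'$ of $v$ in $H$ has $c(v') = c(w')$, delete $v$; return $H$. Algorithm \textsc{All-Colorful}$(H)$ (the tree $T$ implicit): if all vertices of $H$ have the same color, return the set of single-vertex graphs $\{(\{a\},\emptyset) : a \in V_H\}$. Otherwise, let $\alpha$ be a color of vertices of $H$ such that all neighbors of vertices of color $\alpha$ have one same color $\beta$; let $\mathcal{A} = \{a \in V_H : c(a) = \alpha\}$; let $\mathcal{H} = \textsc{All-Colorful}(H - \mathcal{A})$; set $\mathcal{G} := \emptyset$; for each $a \in \mathcal{A}$, let $\mathcal{B} = \{b \in V_H : c(b) = \beta, ab \in E_H\}$, and for each $\widetilde{G} \in \mathcal{H}$ and each $b' \in \mathcal{B}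 \cap V_{\widetilde{G}}$, add to $\mathcal{G}$ the graph $\widetilde{G} + \{ab'\}$ (obtained from $\widetilde{G}$ by adding vertex $a$ and edge $ab'$); return $\mathcal{G}$. -}

module Defs where

open import Data.Nat using (ℕ; zero; suc; _≤_; _≡ᵇ_)
open import Data.Bool using (Bool; true; false; _∧_; _∨_; not; if_then_else_)
open import Data.Fin using (Fin; zero; suc)
open import Data.Fin.Properties using (_≟_)
open import Data.List using (List; []; _∷_; length; map; filter; concatMap; allFin; take; _++_)
open import Data.List.Relation.Unary.Any using (Any)
open import Data.List.Relation.Unary.Unique.Propositional using (Unique)
open import Data.List.Relation.Unary.Linked using (Linked)
open import Data.Maybe using (Maybe; just; nothing)
open import Data.Product using (Σ; ∃; _×_; _,_)
open import Relation.Nullary using (¬_; does)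
open import Relation.Binary.PropositionalEquality using (_≡_)
open import Function.Definitions using (Injective)

anyF : ∀ {m} → (Fin m → Bool) → Bool
anyF {zero}  p = false
anyF {suc m} p = p zero ∨ anyF (λ i → p (suc i))

findF : ∀ {m} → (Fin m → Bool) → Maybe (Fin m)
findF {zero}  p = nothing
findF {suc m} p with p zero
... | true  = just zero
... | false with findF (λ i → p (suc i))
...   | just i  = just (suc i)
...   | nothing = nothing

_==_ : ∀ {n} → Fin n → Fin n → Bool
x == y = does (x ≟ y)

-- Graphs on (a subset of) the vertex set Fin n.
-- V x = true  iff x is a vertex; E x y = true iff xy is an edge.

record Graph (n : ℕ) : Set where
  constructor graph
  field
    V : Fin n → Bool
    E : Fin n → Fin n → Bool
open Graph public

IsSimpleAdj : ∀ {n} → (Fin n → Fin n → Bool) → Set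
IsSimpleAdj {n} E = (∀ x y → E x y ≡ E y x) × (∀ x → E x x ≡ false)

SameGraph : ∀ {n} → Graph n → Graph n → Set
SameGraph G K = (∀ x → V G x ≡ V K x) × (∀ x y → E G x y ≡ E K x y)

_∈G_ : ∀ {n} → Graph n → List (Graph n) → Set
G ∈G 𝒢 = Any (SameGraph G) 𝒢

Subgraph : ∀ {n} → Graph n → Graph n → Set
Subgraph {n} G' H =
  (∀ x → V G' x ≡ true → V H x ≡ true) ×
  (∀ x y → E G' x y ≡ true → E H x y ≡ true) ×
  (∀ x y → E G' x y ≡ true → (V G' x ≡ true) × (V G' y ≡ true)) ×
  (∀ x y → E G' x y ≡ E G' y x)

data Walk {m : ℕ} (E : Fin m → Fin m → Bool) : Fin m → Fin m → Set where
  here : ∀ {u} → Walk E u u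
  step : ∀ {u w v} → E u w ≡ true → Walk E w v → Walk E u v

Connected : ∀ {m} → (Fin m → Fin m → Bool) → Set
Connected {m} E = ∀ (u v : Fin m) → Walk E u v

Adj : ∀ {m} → (Fin m → Fin m → Bool) → Fin m → Fin m → Set
Adj E a b = E a b ≡ true

-- a cycle: at least 3 distinct vertices x₀ … x_k, consecutive ones adjacent,
-- and x_k adjacent to x₀
Cycle : ∀ {m} → (Fin m → Fin m → Bool) → Set
Cycle {m} E = Σ (List (Fin m)) λ xs →
  (3 ≤ length xs) × Unique xs × Linked (Adj E) (xs ++ take 1 xs)

Acyclic : ∀ {m} → (Fin m → Fin m → Bool) → Set
Acyclic E = ¬ Cycle E

IsTree : ∀ {m} → (Fin m → Fin m → Bool) → Set
IsTree {m} E = IsSimpleAdj E × (1 ≤ m) × Connected E × Acyclic E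

module MCG {n m : ℕ} (EG : Fin n → Fin n → Bool) (c : Fin n → ℕ)
           (ET : Fin m → Fin m → Bool) (cT : Fin m → ℕ) where

  colorInT : ℕ → Bool
  colorInT k = anyF (λ w → k ≡ᵇ cT w)

  H₀ : Graph n
  H₀ = graph V₀ E₀
    where
    V₀ : Fin n → Bool
    V₀ v = colorInT (c v)
    E₀ : Fin n → Fin n → Bool
    E₀ v v' = EG v v' ∧ V₀ v ∧ V₀ v' ∧
              anyF (λ w → anyF (λ w' → ET w w' ∧ (c v ≡ᵇ cT w) ∧ (c v' ≡ᵇ cT w')))

  bad : Graph n → Fin n → Bool
  bad H v = V H v ∧ anyF (λ w → anyF (λ w' →
              (c v ≡ᵇ cT w) ∧ ET w w' ∧
              not (anyF (λ v' → E H v v' ∧ (c v' ≡ᵇ cT w')))))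

  deleteV : Graph n → Fin n → Graph n
  deleteV H v = graph (λ x → V H x ∧ not (x == v))
                      (λ x y → E H x y ∧ not (x == v) ∧ not (y == v))

  loop : ℕ → Graph n → Graph n
  loop zero    H = H
  loop (suc k) H with findF (bad H)
  ... | nothing = H
  ... | just v  = loop k (deleteV H v)

  -- at most n deletions can happen, so n+1 iterations reach the end of the loop
  mcg : Graph n
  mcg = loop (suc n) H₀

-- Algorithm All-Colorful(H), as a relation "AllColorful H 𝒢" meaning
-- "some run of All-Colorful on H returns 𝒢" (the choice of α is arbitrary
-- among the admissible ones).

module AllColorfulAlg {n : ℕ} (c : Fin n → ℕ) where

  verts : Graph n → List (Fin n)
  verts H = filter (λ x → V H x Data.Bool.≟ true) (allFin n)

  single : Fin n → Graph n
  single a = graph (λ x → x == a) (λ _ _ → false)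

  AllSameColor : Graph n → Set
  AllSameColor H = ∀ x y → V H x ≡ true → V H y ≡ true → c x ≡ c y

  removeColor : ℕ → Graph n → Graph n
  removeColor α H = graph (λ x → V H x ∧ not (c x ≡ᵇ α))
                          (λ x y → E H x y ∧ not (c x ≡ᵇ α) ∧ not (c y ≡ᵇ α))

  addLeaf : Graph n → Fin n → Fin n → Graph n
  addLeaf G a b = graph (λ x → V G x ∨ (x == a))
                        (λ x y → E G x y ∨ ((x == a) ∧ (y == b)) ∨ ((x == b) ∧ (y == a)))

  classOf : ℕ → Graph n → List (Fin n)
  classOf α H = filter (λ x → (V H x ∧ (c x ≡ᵇ α)) Data.Bool.≟ true) (allFin n)

  candidates : Graph n → ℕ → Fin n → Graph n → List (Fin n)
  candidates H β a G = filter (λ b → ((c b ≡ᵇ β) ∧ E H a b ∧ V G b) Data.Bool.≟ true) (allFin n)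

  combine : Graph n → ℕ → ℕ → List (Graph n) → List (Graph n)
  combine H α β ℋ =
    concatMap (λ a → concatMap (λ G → map (addLeaf G a) (candidates H β a G)) ℋ)
              (classOf α H)

  data AllColorful : Graph n → List (Graph n) → Set where
    base : ∀ {H} → AllSameColor H → AllColorful H (map single (verts H))
    rec  : ∀ {H ℋ} (α β : ℕ) →
           ¬ AllSameColor H →
           (∃ λ v → (V H v ≡ true) × (c v ≡ α)) →
           (∀ a x → V H a ≡ true → c a ≡ α → E H a x ≡ true → c x ≡ β) →
           AllColorful (removeColor α H) ℋ →
           AllColorful H (combine H α β ℋ)

ColorIso : ∀ {n m} (c : Fin n → ℕ) → Graph n →
           (Fin m → Fin m → Bool) → (Fin m → ℕ) → Set
ColorIso {n} {m} c G' ET cT = Σ (Fin m → Fin n) λ f →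
  Injective _≡_ _≡_ f ×
  (∀ w → V G' (f w) ≡ true) ×
  (∀ x → V G' x ≡ true → ∃ λ w → f w ≡ x) ×
  (∀ w → c (f w) ≡ cT w) ×
  (∀ w w' → E G' (f w) (f w') ≡ ET w w')

module Submission where

-- H = mcg(G,T) is a cover of T: each vertex of H carries the colour of a vertex w of T, each
-- edge of H joins colours adjacent in T, and a vertex of colour w has, for every neighbour w'
-- of w in T, a neighbour of colour w'. In a cover of a subtree S, a colour class α all of whose
-- neighbours have one colour β must be the class of a leaf of S whose neighbour has colour β,
-- and deleting that class leaves a cover of S minus the leaf. A colourful copy of S is a copy
-- of S minus the leaf plus one edge from an α-vertex to the copy of the neighbour, which is
-- exactly how All-Colorful extends the graphs returned by its recursive call; induction along
-- the run gives both directions of the equivalence. A run exists since every subtree with two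
-- vertices or more has a leaf.

open import Defs
open import Data.Bool using (Bool; true; false; _∧_; _∨_; not; if_then_else_)
open import Data.Bool.Properties
  using (∧-identityʳ; ∧-zeroʳ; ∧-comm; ∨-comm; ∨-identityʳ; ¬-not)
open import Data.Empty using (⊥)
open import Data.Fin using (Fin; zero; suc)
open import Data.Fin.Properties using (_≟_; any?; pigeonhole)
import Data.Fin.Properties as Fin
open import Data.List using (List; []; _∷_; length; lookup; _++_; map; allFin)
open import Data.List.Membership.Propositional using (_∈_; find; lose)
open import Data.List.Membership.Propositional.Properties
  using (∈-lookup; ∈-filter⁺; ∈-filter⁻; ∈-map⁻; ∈-allFin)
open import Data.List.Relation.Unary.All using (All; []; _∷_)
import Data.List.Relation.Unary.All as All
open import Data.List.Relation.Unary.All.Properties.Core using (¬Any⇒All¬)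
open import Data.List.Relation.Unary.Any using (Any; here; there)
import Data.List.Relation.Unary.Any.Properties as AnyP
open import Data.List.Relation.Unary.Linked using (Linked; []; [-]; _∷_)
open import Data.List.Relation.Unary.Unique.Propositional using (Unique; []; _∷_)
open import Data.Maybe using (just; nothing)
open import Data.Nat as ℕ using (ℕ; zero; suc; _+_; _≤_; _<_; z≤n; s≤s)
open import Data.Nat.Properties as ℕ using (≤-pred; +-suc; ≮⇒≥)
open import Data.Product using (Σ; ∃; ∃₂; _×_; _,_; proj₁; proj₂)
open import Data.Sum using (_⊎_; inj₁; inj₂)
open import Function using (_∘_)
open import Function.Bundles using (_⇔_; mk⇔)
open import Function.Definitions using (Injective)
open import Relation.Nullary using (¬_; Dec; yes; no; does; ¬?; _×-dec_; contradiction)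
open import Relation.Nullary.Decidable using (dec-true; dec-false)
open import Relation.Binary.PropositionalEquality
  using (_≡_; _≢_; refl; sym; trans; cong; cong₂; subst)

private variable
  k : ℕ

decided : ∀ {ℓ} {A : Set ℓ} (d : Dec A) → does d ≡ true → A
decided (yes a) _ = a

∧-true⁻ : ∀ {a b} → a ∧ b ≡ true → a ≡ true × b ≡ true
∧-true⁻ {true} {true} refl = refl , refl

∧-true⁺ : ∀ {a b} → a ≡ true → b ≡ true → a ∧ b ≡ true
∧-true⁺ refl refl = refl

∨-true⁻ : ∀ {a b} → a ∨ b ≡ true → a ≡ true ⊎ b ≡ true
∨-true⁻ {true} refl = inj₁ refl
∨-true⁻ {false} refl = inj₂ refl

∨-true⁺ˡ : ∀ {a} b → a ≡ true → a ∨ b ≡ true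
∨-true⁺ˡ b refl = refl

∨-true⁺ʳ : ∀ a {b} → b ≡ true → a ∨ b ≡ true
∨-true⁺ʳ true refl = refl
∨-true⁺ʳ false refl = refl

not-true⁺ : ∀ {a} → a ≡ false → not a ≡ true
not-true⁺ refl = refl

not-true⁻ : ∀ {a} → not a ≡ true → a ≡ false
not-true⁻ {false} refl = refl

true⇔⇒≡ : ∀ {a b} → (a ≡ true → b ≡ true) → (b ≡ true → a ≡ true) → a ≡ b
true⇔⇒≡ {true} to _ = sym (to refl)
true⇔⇒≡ {false} {true} _ from = from refl
true⇔⇒≡ {false} {false} _ _ = refl

==-refl : (x : Fin k) → x == x ≡ true
==-refl x = dec-true (x ≟ x) refl

==⇒≡ : {x y : Fin k} → x == y ≡ true → x ≡ y
==⇒≡ {x = x} {y} = decided (x ≟ y)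

≡ᵇ⇒≡ : ∀ {a b} → (a ℕ.≡ᵇ b) ≡ true → a ≡ b
≡ᵇ⇒≡ {a} {b} = decided (a ℕ.≟ b)

≡⇒≡ᵇ : ∀ {a b} → a ≡ b → (a ℕ.≡ᵇ b) ≡ true
≡⇒≡ᵇ {a} {b} = dec-true (a ℕ.≟ b)

≢⇒≡ᵇ : ∀ {a b} → a ≢ b → (a ℕ.≡ᵇ b) ≡ false
≢⇒≡ᵇ {a} {b} = dec-false (a ℕ.≟ b)

_without_ : (Fin k → Bool) → Fin k → Fin k → Bool
(S without l) u = S u ∧ not (u == l)

without⁺ : ∀ {S : Fin k → Bool} {l u} → S u ≡ true → u ≢ l → (S without l) u ≡ true
without⁺ {l = l} {u} Su u≢l = ∧-true⁺ Su (not-true⁺ (dec-false (u ≟ l) u≢l))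

without⁻ : ∀ {S : Fin k → Bool} {l u} → (S without l) u ≡ true → S u ≡ true × u ≢ l
without⁻ {l = l} {u} S'u with ∧-true⁻ S'u
... | Su , u≠l =
  Su , λ u≡l → contradiction (trans (sym (dec-true (u ≟ l) u≡l)) (not-true⁻ u≠l)) λ ()

subsingleton-or-other : (S : Fin k → Bool) (w : Fin k) →
                        (∀ u → S u ≡ true → u ≡ w) ⊎ (∃ λ u → S u ≡ true × u ≢ w)
subsingleton-or-other S w with any? (λ u → (S u Data.Bool.≟ true) ×-dec ¬? (u ≟ w))
... | yes other = inj₂ other
... | no no-other = inj₁ only-w
  where
  only-w : ∀ u → S u ≡ true → u ≡ w
  only-w u Su with u ≟ w
  ... | yes u≡w = u≡w
  ... | no u≢w = contradiction (u , Su , u≢w) no-other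

anyF⁻ : {p : Fin k → Bool} → anyF p ≡ true → ∃ λ i → p i ≡ true
anyF⁻ {suc k} {p} h with ∨-true⁻ {p zero} h
... | inj₁ p0 = zero , p0
... | inj₂ ps with anyF⁻ ps
...   | i , pi = suc i , pi

anyF⁺ : {p : Fin k → Bool} (i : Fin k) → p i ≡ true → anyF p ≡ true
anyF⁺ {suc k} zero pi = ∨-true⁺ˡ _ pi
anyF⁺ {suc k} {p} (suc i) pi = ∨-true⁺ʳ (p zero) (anyF⁺ i pi)

findF-nothing : (p : Fin k → Bool) → findF p ≡ nothing → ∀ i → p i ≡ false
findF-nothing {suc k} p h i with p zero in p0
findF-nothing {suc k} p () i | true
... | false with findF (p ∘ suc) in ps
findF-nothing {suc k} p () i | false | just _
findF-nothing {suc k} p h zero | false | nothing = p0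
findF-nothing {suc k} p h (suc i) | false | nothing = findF-nothing (p ∘ suc) ps i

findF-just : (p : Fin k → Bool) {v : Fin k} → findF p ≡ just v → p v ≡ true
findF-just {suc k} p h with p zero in p0
findF-just {suc k} p refl | true = p0
... | false with findF (p ∘ suc) in ps
findF-just {suc k} p refl | false | just i = findF-just (p ∘ suc) ps
findF-just {suc k} p () | false | nothing

count : (Fin k → Bool) → ℕ
count {zero} p = 0
count {suc k} p = (if p zero then 1 else 0) + count (p ∘ suc)

count-≤ : (p : Fin k → Bool) → count p ≤ k
count-≤ {zero} p = z≤n
count-≤ {suc k} p with p zero
... | true = s≤s (count-≤ (p ∘ suc))
... | false = ℕ.m≤n⇒m≤1+n (count-≤ (p ∘ suc))

count-cong : (p q : Fin k → Bool) → (∀ x → p x ≡ q x) → count p ≡ count q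
count-cong {zero} p q p≗q = refl
count-cong {suc k} p q p≗q rewrite p≗q zero =
  cong (_ +_) (count-cong (p ∘ suc) (q ∘ suc) (p≗q ∘ suc))

count-without : (p : Fin k → Bool) (v : Fin k) → p v ≡ true →
                count p ≡ suc (count (p without v))
count-without {suc k} p zero pv rewrite pv =
  cong suc (count-cong (p ∘ suc) _ (λ x → sym (∧-identityʳ (p (suc x)))))
count-without {suc k} p (suc v) pv with p zero
... | true = cong suc (count-without (p ∘ suc) v pv)
... | false = count-without (p ∘ suc) v pv

lookup-injective : ∀ {a} {A : Set a} {xs : List A} → Unique xs →
                   ∀ i j → lookup xs i ≡ lookup xs j → i ≡ j
lookup-injective (x∉ ∷ u) zero zero eq = refl
lookup-injective (x∉ ∷ u) zero (suc j) eq = contradiction eq (All.lookup x∉ (∈-lookup j))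
lookup-injective (x∉ ∷ u) (suc i) zero eq = contradiction (sym eq) (All.lookup x∉ (∈-lookup i))
lookup-injective (x∉ ∷ u) (suc i) (suc j) eq = cong suc (lookup-injective u i j eq)

Unique⇒length≤ : {xs : List (Fin k)} → Unique xs → length xs ≤ k
Unique⇒length≤ {xs = xs} u = ≮⇒≥ λ k<len →
  let i , j , i<j , eq = pigeonhole k<len (lookup xs)
  in Fin.<-irrefl (lookup-injective u i j eq) i<j

module AllColorfulLists {n : ℕ} (c : Fin n → ℕ) where
  open AllColorfulAlg c

  ∈-verts⁻ : ∀ {H a} → a ∈ verts H → V H a ≡ true
  ∈-verts⁻ a∈ = proj₂ (∈-filter⁻ _ {xs = allFin n} a∈)

  ∈-verts⁺ : ∀ {H a} → V H a ≡ true → a ∈ verts H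
  ∈-verts⁺ {a = a} = ∈-filter⁺ _ (∈-allFin a)

  ∈-classOf⁻ : ∀ {α H a} → a ∈ classOf α H → V H a ≡ true × c a ≡ α
  ∈-classOf⁻ a∈ =
    let Va , ca = ∧-true⁻ (proj₂ (∈-filter⁻ _ {xs = allFin n} a∈)) in Va , ≡ᵇ⇒≡ ca

  ∈-classOf⁺ : ∀ {α H a} → V H a ≡ true → c a ≡ α → a ∈ classOf α H
  ∈-classOf⁺ {a = a} Va ca = ∈-filter⁺ _ (∈-allFin a) (∧-true⁺ Va (≡⇒≡ᵇ ca))

  ∈-candidates⁻ : ∀ {H β a G b} → b ∈ candidates H β a G →
                  c b ≡ β × E H a b ≡ true × V G b ≡ true
  ∈-candidates⁻ b∈ =
    let cb , rest = ∧-true⁻ (proj₂ (∈-filter⁻ _ {xs = allFin n} b∈)) ; eab , Vb = ∧-true⁻ rest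
    in ≡ᵇ⇒≡ cb , eab , Vb

  ∈-candidates⁺ : ∀ {H β a G b} → c b ≡ β → E H a b ≡ true → V G b ≡ true →
                  b ∈ candidates H β a G
  ∈-candidates⁺ {b = b} cb eab Vb =
    ∈-filter⁺ _ (∈-allFin b) (∧-true⁺ (≡⇒≡ᵇ cb) (∧-true⁺ eab Vb))

  ∈-combine⁻ : ∀ {H α β ℋ K} → K ∈ combine H α β ℋ →
               ∃ λ a → ∃₂ λ G b → a ∈ classOf α H × G ∈ ℋ × b ∈ candidates H β a G ×
                                  K ≡ addLeaf G a b
  ∈-combine⁻ {H} {α} {ℋ = ℋ} K∈ =
    let a , a∈ , K∈a = find (AnyP.concatMap⁻ _ {xs = classOf α H} K∈)
        G , G∈ , K∈aG = find (AnyP.concatMap⁻ _ {xs = ℋ} K∈a)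
        b , b∈ , K≡ = ∈-map⁻ (addLeaf G a) K∈aG
    in a , G , b , a∈ , G∈ , b∈ , K≡

  Any-combine⁺ : ∀ {H α β ℋ a G b} {P : Graph n → Set} → a ∈ classOf α H → G ∈ ℋ →
                 b ∈ candidates H β a G → P (addLeaf G a b) → Any P (combine H α β ℋ)
  Any-combine⁺ a∈ G∈ b∈ P =
    AnyP.concatMap⁺ _ (lose a∈ (AnyP.concatMap⁺ _ (lose G∈ (AnyP.map⁺ (lose b∈ P)))))

  removeColor-mono : ∀ α {G H} → Subgraph G H → Subgraph (removeColor α G) (removeColor α H)
  removeColor-mono α (V⊆ , E⊆ , ends , G-sym) =
    (λ x V'x → let Vx , ¬αx = ∧-true⁻ V'x in ∧-true⁺ (V⊆ x Vx) ¬αx) ,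
    (λ x y e'xy → let exy , ¬α¬α = ∧-true⁻ e'xy in ∧-true⁺ (E⊆ x y exy) ¬α¬α) ,
    (λ x y e'xy →
      let exy , ¬α¬α = ∧-true⁻ e'xy ; ¬αx , ¬αy = ∧-true⁻ ¬α¬α ; Vx , Vy = ends x y exy
      in ∧-true⁺ Vx ¬αx , ∧-true⁺ Vy ¬αy) ,
    (λ x y → cong₂ _∧_ (G-sym x y) (∧-comm (not (c x ℕ.≡ᵇ α)) _))

  addLeaf-vertex⁻ : ∀ G a b {x} → V (addLeaf G a b) x ≡ true → V G x ≡ true ⊎ x ≡ a
  addLeaf-vertex⁻ G a b Vx with ∨-true⁻ Vx
  ... | inj₁ VGx = inj₁ VGx
  ... | inj₂ x=a = inj₂ (==⇒≡ x=a)

  addLeaf-edge⁻ : ∀ G a b {x y} → E (addLeaf G a b) x y ≡ true →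
                  E G x y ≡ true ⊎ (x ≡ a × y ≡ b) ⊎ (x ≡ b × y ≡ a)
  addLeaf-edge⁻ G a b exy with ∨-true⁻ exy
  ... | inj₁ eG = inj₁ eG
  ... | inj₂ new with ∨-true⁻ new
  ...   | inj₁ ab = let x=a , y=b = ∧-true⁻ ab in inj₂ (inj₁ (==⇒≡ x=a , ==⇒≡ y=b))
  ...   | inj₂ ba = let x=b , y=a = ∧-true⁻ ba in inj₂ (inj₂ (==⇒≡ x=b , ==⇒≡ y=a))

  addLeaf-edge-ab : ∀ G a b → E (addLeaf G a b) a b ≡ true
  addLeaf-edge-ab G a b = ∨-true⁺ʳ (E G a b) (∨-true⁺ˡ _ (∧-true⁺ (==-refl a) (==-refl b)))

  addLeaf-edge-ba : ∀ G a b → E (addLeaf G a b) b a ≡ true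
  addLeaf-edge-ba G a b = ∨-true⁺ʳ (E G b a) (∨-true⁺ʳ _ (∧-true⁺ (==-refl b) (==-refl a)))

  addLeaf-symmetric : ∀ G a b → (∀ x y → E G x y ≡ E G y x) →
                      ∀ x y → E (addLeaf G a b) x y ≡ E (addLeaf G a b) y x
  addLeaf-symmetric G a b G-sym x y =
    cong₂ _∨_ (G-sym x y)
      (trans (∨-comm ((x == a) ∧ (y == b)) _) (cong₂ _∨_ (∧-comm (x == b) _) (∧-comm (x == a) _)))

module Subtrees {m : ℕ} (ET : Fin m → Fin m → Bool)
                (ET-sym : ∀ x y → ET x y ≡ ET y x) (ET-irrefl : ∀ x → ET x x ≡ false) where

  open import Data.List.Membership.DecPropositional (_≟_ {m}) using (_∈?_)

  data WalkIn (S : Fin m → Bool) : Fin m → Fin m → Set where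
    here : ∀ {u} → WalkIn S u u
    step : ∀ {u x v} → ET u x ≡ true → S x ≡ true → WalkIn S x v → WalkIn S u v

  ConnectedIn : (Fin m → Bool) → Set
  ConnectedIn S = ∀ u v → S u ≡ true → S v ≡ true → WalkIn S u v

  whole : Fin m → Bool
  whole _ = true

  connected⇒connectedIn-whole : Connected ET → ConnectedIn whole
  connected⇒connectedIn-whole connected u v _ _ = along (connected u v)
    where
    along : ∀ {u v} → Walk ET u v → WalkIn whole u v
    along here = here
    along (step e w) = step e refl (along w)

  adjacent⇒≢ : ∀ {u v} → ET u v ≡ true → u ≢ v
  adjacent⇒≢ {u} e refl = contradiction (trans (sym e) (ET-irrefl u)) λ ()

  record Leaf (S : Fin m → Bool) : Set where
    field
      leaf neighbour : Fin m
      leaf∈ : S leaf ≡ true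
      neighbour∈ : S neighbour ≡ true
      leaf-adjacent : ET leaf neighbour ≡ true
      unique-neighbour : ∀ x → S x ≡ true → ET leaf x ≡ true → x ≡ neighbour

    neighbour≢leaf : neighbour ≢ leaf
    neighbour≢leaf = adjacent⇒≢ leaf-adjacent ∘ sym

  private
    prefixTo : ∀ {y : Fin m} {xs} → y ∈ xs → List (Fin m)
    prefixTo {xs = x ∷ _} (here _) = x ∷ []
    prefixTo {xs = x ∷ _} (there p) = x ∷ prefixTo p

    prefixTo-nonempty : ∀ {y : Fin m} {xs} (p : y ∈ xs) → 1 ≤ length (prefixTo p)
    prefixTo-nonempty (here _) = s≤s z≤n
    prefixTo-nonempty (there _) = s≤s z≤n

    All-prefixTo : ∀ {P : Fin m → Set} {y xs} → All P xs → (p : y ∈ xs) → All P (prefixTo p)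
    All-prefixTo (Px ∷ _) (here _) = Px ∷ []
    All-prefixTo (Px ∷ Pxs) (there p) = Px ∷ All-prefixTo Pxs p

    Unique-prefixTo : ∀ {y : Fin m} {xs} → Unique xs → (p : y ∈ xs) → Unique (prefixTo p)
    Unique-prefixTo (_ ∷ _) (here _) = [] ∷ []
    Unique-prefixTo (x∉ ∷ u) (there p) = All-prefixTo x∉ p ∷ Unique-prefixTo u p

    Linked-prefixTo : ∀ {z y t : Fin m} {xs} → Linked (Adj ET) (z ∷ xs) → (p : y ∈ xs) →
                      ET y t ≡ true → Linked (Adj ET) (z ∷ prefixTo p ++ t ∷ [])
    Linked-prefixTo (e ∷ _) (here refl) eyt = e ∷ eyt ∷ [-]
    Linked-prefixTo (e ∷ l) (there p) eyt = e ∷ Linked-prefixTo l p eyt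

  cycle-closing : ∀ {h q y : Fin m} {rest} → Unique (h ∷ q ∷ rest) →
                  Linked (Adj ET) (h ∷ q ∷ rest) → y ∈ rest → ET h y ≡ true → Cycle ET
  cycle-closing {h} {y = y} ((h≢q ∷ h∉) ∷ (q∉ ∷ u)) (ehq ∷ l) p ehy =
    h ∷ _ ∷ prefixTo p ,
    s≤s (s≤s (prefixTo-nonempty p)) ,
    (h≢q ∷ All-prefixTo h∉ p) ∷ All-prefixTo q∉ p ∷ Unique-prefixTo u p ,
    ehq ∷ Linked-prefixTo l p (trans (ET-sym y h) ehy)

  module _ (acyclic : Acyclic ET) {S : Fin m → Bool} where

    -- Grow a path h q … inside S at its head h until the head is a leaf; the head can never
    -- revisit the path, as that would close a cycle, so the path stays Unique and has at most
    -- m vertices.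
    leaf-beyond-path : ∀ fuel h q rest → S h ≡ true → S q ≡ true → Unique (h ∷ q ∷ rest) →
                       Linked (Adj ET) (h ∷ q ∷ rest) → m < length (h ∷ q ∷ rest) + fuel →
                       Leaf S
    leaf-beyond-path zero h q rest _ _ u _ bound =
      contradiction (Unique⇒length≤ u) (ℕ.<⇒≱ (subst (m <_) (ℕ.+-identityʳ _) bound))
    leaf-beyond-path (suc fuel) h q rest Sh Sq u l@(ehq ∷ _) bound
      with any? (λ y → (S y Data.Bool.≟ true) ×-dec (ET h y Data.Bool.≟ true) ×-dec ¬? (y ≟ q))
    ... | no no-other = record
      { leaf = h ; neighbour = q ; leaf∈ = Sh ; neighbour∈ = Sq ; leaf-adjacent = ehq
      ; unique-neighbour = only-q }
      where
      only-q : ∀ x → S x ≡ true → ET h x ≡ true → x ≡ q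
      only-q x Sx ehx with x ≟ q
      ... | yes x≡q = x≡q
      ... | no x≢q = contradiction (x , Sx , ehx , x≢q) no-other
    ... | yes (y , Sy , ehy , y≢q) with y ∈? (h ∷ q ∷ rest)
    ... | no y∉ = leaf-beyond-path fuel y h (q ∷ rest) Sy Sh (¬Any⇒All¬ _ y∉ ∷ u)
                    (trans (ET-sym y h) ehy ∷ l) (subst (m <_) (+-suc _ fuel) bound)
    ... | yes (here refl) = contradiction refl (adjacent⇒≢ ehy)
    ... | yes (there (here y≡q)) = contradiction y≡q y≢q
    ... | yes (there (there p)) = contradiction (cycle-closing u l p ehy) acyclic

    leaf-exists : ConnectedIn S → ∀ {u v} → S u ≡ true → S v ≡ true → u ≢ v → Leaf S
    leaf-exists connected {u} {v} Su Sv u≢v with connected u v Su Sv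
    ... | here = contradiction refl u≢v
    ... | step {x = x} eux Sx _ =
      leaf-beyond-path m x u [] Sx Su ((adjacent⇒≢ exu ∷ []) ∷ [] ∷ []) (exu ∷ [-]) (ℕ.n≤1+n _)
      where
      exu : ET x u ≡ true
      exu = trans (ET-sym x u) eux

  module _ {S : Fin m → Bool} (L : Leaf S) where
    open Leaf L

    walk-avoiding-leaf : ∀ {x y} → S x ≡ true → x ≢ leaf → y ≢ leaf → WalkIn S x y →
                         WalkIn (S without leaf) x y
    walk-avoiding-leaf Sx x≢l y≢l here = here
    walk-avoiding-leaf Sx x≢l y≢l (step {x = z} e Sz w) with z ≟ leaf
    ... | no z≢l = step e (without⁺ {S = S} Sz z≢l) (walk-avoiding-leaf Sz z≢l y≢l w)
    walk-avoiding-leaf Sx x≢l y≢l (step e Sz here) | yes refl = contradiction refl y≢l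
    walk-avoiding-leaf {x} Sx x≢l y≢l (step e Sz (step {x = z'} e' Sz' w)) | yes refl =
      subst (λ s → WalkIn _ s _) (sym x≡z')
        (walk-avoiding-leaf Sz' (subst (_≢ leaf) x≡z' x≢l) y≢l w)
      where
      -- both x and z' are neighbours of the leaf, hence both equal its unique neighbour
      x≡z' : x ≡ z'
      x≡z' = trans (unique-neighbour x Sx (trans (ET-sym leaf x) e))
                   (sym (unique-neighbour z' Sz' e'))

    connectedIn-without-leaf : ConnectedIn S → ConnectedIn (S without leaf)
    connectedIn-without-leaf connected u v S'u S'v =
      let Su , u≢l = without⁻ {S = S} S'u ; Sv , v≢l = without⁻ {S = S} S'v
      in walk-avoiding-leaf Su u≢l v≢l (connected u v Su Sv)

module Covers {n m : ℕ} (c : Fin n → ℕ) (ET : Fin m → Fin m → Bool) (cT : Fin m → ℕ)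
              (ET-sym : ∀ x y → ET x y ≡ ET y x) (ET-irrefl : ∀ x → ET x x ≡ false)
              (cT-injective : Injective _≡_ _≡_ cT) where
  open Subtrees ET ET-sym ET-irrefl
  open AllColorfulAlg c
  open AllColorfulLists c

  record Cover (S : Fin m → Bool) (H : Graph n) : Set where
    field
      colour∈ : ∀ x → V H x ≡ true → ∃ λ w → S w ≡ true × c x ≡ cT w
      edge∈ : ∀ x y → E H x y ≡ true → V H x ≡ true × V H y ≡ true ×
              ∃₂ λ u v → S u ≡ true × S v ≡ true × ET u v ≡ true × c x ≡ cT u × c y ≡ cT v
      lift : ∀ x w w' → V H x ≡ true → c x ≡ cT w → S w ≡ true → S w' ≡ true →
             ET w w' ≡ true → ∃ λ y → E H x y ≡ true × c y ≡ cT w'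
      symmetric : ∀ x y → E H x y ≡ E H y x
      nonempty : ∃ λ x → V H x ≡ true
      connected : ConnectedIn S

  other-vertex⇒other-colour : ∀ {x u l} → c x ≡ cT u → u ≢ l → (c x ℕ.≡ᵇ cT l) ≡ false
  other-vertex⇒other-colour cx u≢l = ≢⇒≡ᵇ λ cx≡cl → u≢l (cT-injective (trans (sym cx) cx≡cl))

  other-colour⇒other-vertex : ∀ {x u l} → not (c x ℕ.≡ᵇ cT l) ≡ true → c x ≡ cT u → u ≢ l
  other-colour⇒other-vertex ¬cl cx refl =
    contradiction (trans (sym (≡⇒≡ᵇ cx)) (not-true⁻ ¬cl)) λ ()

  module _ {S : Fin m → Bool} {H : Graph n} (cover : Cover S H) where
    open Cover cover

    colour-realised : ∀ u → S u ≡ true → ∃ λ y → V H y ≡ true × c y ≡ cT u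
    colour-realised u Su =
      let x , Vx = nonempty ; w , Sw , cx = colour∈ x Vx in along x Vx cx (connected w u Sw Su)
      where
      along : ∀ {w u} x → V H x ≡ true → c x ≡ cT w → WalkIn S w u →
              ∃ λ y → V H y ≡ true × c y ≡ cT u
      along x Vx cx here = x , Vx , cx
      along x Vx cx (step {x = z} e Sz walk) with colour∈ x Vx
      ... | w , Sw , cxw with cT-injective (trans (sym cxw) cx)
      ... | refl = let y , exy , cy = lift x w z Vx cxw Sw Sz e
                   in along y (proj₁ (proj₂ (edge∈ x y exy))) cy walk

    allSameColor⇒subsingleton : AllSameColor H → ∀ u v → S u ≡ true → S v ≡ true → u ≡ v
    allSameColor⇒subsingleton same u v Su Sv =
      let x , Vx , cx = colour-realised u Su ; y , Vy , cy = colour-realised v Sv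
      in cT-injective (trans (sym cx) (trans (same x y Vx Vy) cy))

    subsingleton⇒allSameColor : ∀ w → (∀ u → S u ≡ true → u ≡ w) → AllSameColor H
    subsingleton⇒allSameColor w only-w x y Vx Vy =
      let u , Su , cx = colour∈ x Vx ; v , Sv , cy = colour∈ y Vy
      in trans cx (trans (cong cT (trans (only-w u Su) (sym (only-w v Sv)))) (sym cy))

    -- S is connected and not a singleton, so the vertex w of colour α has a neighbour in S;
    -- each neighbour of w lifts to a neighbour of an α-vertex, so has colour β, and is unique
    -- as cT is injective.
    admissible⇒leaf : ∀ α β → ¬ AllSameColor H → (∃ λ v → V H v ≡ true × c v ≡ α) →
                      (∀ a x → V H a ≡ true → c a ≡ α → E H a x ≡ true → c x ≡ β) →
                      Σ (Leaf S) λ L → cT (Leaf.leaf L) ≡ α × cT (Leaf.neighbour L) ≡ β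
    admissible⇒leaf α β mixed (v , Vv , cv) α-β with colour∈ v Vv
    ... | w , Sw , cvw with subsingleton-or-other S w
    ... | inj₁ only-w = contradiction (subsingleton⇒allSameColor w only-w) mixed
    ... | inj₂ (u , Su , u≢w) with connected w u Sw Su
    ... | here = contradiction refl u≢w
    ... | step {x = w'} eww' Sw' _ =
      record { leaf = w ; neighbour = w' ; leaf∈ = Sw ; neighbour∈ = Sw' ; leaf-adjacent = eww'
             ; unique-neighbour = λ u' Su' ewu' →
                 cT-injective (trans (sym (colour-β u' Su' ewu')) (colour-β w' Sw' eww')) } ,
      trans (sym cvw) cv , sym (colour-β w' Sw' eww')
      where
      colour-β : ∀ u' → S u' ≡ true → ET w u' ≡ true → β ≡ cT u'
      colour-β u' Su' ewu' =
        let y , evy , cy = lift v w u' Vv cvw Sw Su' ewu' in trans (sym (α-β v y Vv cv evy)) cy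

    leaf-colour-admissible : (L : Leaf S) → let open Leaf L in
                             ∀ a x → V H a ≡ true → c a ≡ cT leaf → E H a x ≡ true →
                             c x ≡ cT neighbour
    leaf-colour-admissible L a x Va ca eax with edge∈ a x eax
    ... | _ , _ , u , v , _ , Sv , euv , cau , cxv with cT-injective (trans (sym cau) ca)
    ... | refl = trans cxv (cong cT (Leaf.unique-neighbour L v Sv euv))

  module _ {S : Fin m → Bool} {H : Graph n} (cover : Cover S H) (L : Leaf S) where
    open Cover cover
    open Leaf L

    private
      in-S⁻ : ∀ {x u} → S u ≡ true → not (c x ℕ.≡ᵇ cT leaf) ≡ true → c x ≡ cT u →
              (S without leaf) u ≡ true
      in-S⁻ Su ¬α cx = without⁺ {S = S} Su (other-colour⇒other-vertex ¬α cx)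

    cover-without-leaf : Cover (S without leaf) (removeColor (cT leaf) H)
    cover-without-leaf = record
      { colour∈ = λ x V⁻x →
          let Vx , ¬α = ∧-true⁻ V⁻x ; u , Su , cx = colour∈ x Vx in u , in-S⁻ Su ¬α cx , cx
      ; edge∈ = edge∈⁻
      ; lift = lift⁻
      ; symmetric = λ x y → cong₂ _∧_ (symmetric x y) (∧-comm (not (c x ℕ.≡ᵇ cT leaf)) _)
      ; nonempty = nonempty⁻
      ; connected = connectedIn-without-leaf L connected
      }
      where
      H⁻ : Graph n
      H⁻ = removeColor (cT leaf) H
      edge∈⁻ : ∀ x y → E H⁻ x y ≡ true → V H⁻ x ≡ true × V H⁻ y ≡ true ×
               ∃₂ λ u v → (S without leaf) u ≡ true × (S without leaf) v ≡ true ×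
                          ET u v ≡ true × c x ≡ cT u × c y ≡ cT v
      edge∈⁻ x y e⁻xy with ∧-true⁻ e⁻xy
      ... | exy , ¬α¬α with ∧-true⁻ ¬α¬α | edge∈ x y exy
      ... | ¬αx , ¬αy | Vx , Vy , u , v , Su , Sv , euv , cx , cy =
        ∧-true⁺ Vx ¬αx , ∧-true⁺ Vy ¬αy , u , v , in-S⁻ Su ¬αx cx , in-S⁻ Sv ¬αy cy , euv , cx , cy
      lift⁻ : ∀ x w w' → V H⁻ x ≡ true → c x ≡ cT w → (S without leaf) w ≡ true →
              (S without leaf) w' ≡ true → ET w w' ≡ true → ∃ λ y → E H⁻ x y ≡ true × c y ≡ cT w'
      lift⁻ x w w' V⁻x cx S⁻w S⁻w' eww' =
        let Vx , ¬αx = ∧-true⁻ V⁻x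
            Sw , _ = without⁻ {S = S} S⁻w ; Sw' , w'≢l = without⁻ {S = S} S⁻w'
            y , exy , cy = lift x w w' Vx cx Sw Sw' eww'
        in y , ∧-true⁺ exy (∧-true⁺ ¬αx (not-true⁺ (other-vertex⇒other-colour cy w'≢l))) , cy
      nonempty⁻ : ∃ λ x → V H⁻ x ≡ true
      nonempty⁻ =
        let x , Vx , cx = colour-realised cover leaf leaf∈
            y , exy , cy = lift x leaf neighbour Vx cx leaf∈ neighbour∈ leaf-adjacent
        in y , ∧-true⁺ (proj₁ (proj₂ (edge∈ x y exy)))
                       (not-true⁺ (other-vertex⇒other-colour cy neighbour≢leaf))

  record ColourIsoOn (S : Fin m → Bool) (G : Graph n) : Set where
    field
      embed : Fin m → Fin n
      injective : ∀ u v → S u ≡ true → S v ≡ true → embed u ≡ embed v → u ≡ v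
      embed∈ : ∀ u → S u ≡ true → V G (embed u) ≡ true
      onto : ∀ x → V G x ≡ true → ∃ λ u → S u ≡ true × embed u ≡ x
      preserves-colour : ∀ u → S u ≡ true → c (embed u) ≡ cT u
      preserves-edge : ∀ u v → S u ≡ true → S v ≡ true → E G (embed u) (embed v) ≡ ET u v

  ColourIsoOn-resp : ∀ {S G K} → SameGraph G K → ColourIsoOn S K → ColourIsoOn S G
  ColourIsoOn-resp (V≗ , E≗) iso = record
    { embed = embed
    ; injective = injective
    ; embed∈ = λ u Su → trans (V≗ (embed u)) (embed∈ u Su)
    ; onto = λ x Vx → onto x (trans (sym (V≗ x)) Vx)
    ; preserves-colour = preserves-colour
    ; preserves-edge = λ u v Su Sv → trans (E≗ (embed u) (embed v)) (preserves-edge u v Su Sv)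
    }
    where open ColourIsoOn iso

  ColorIso⇒ColourIsoOn : ∀ {G} → ColorIso c G ET cT → ColourIsoOn whole G
  ColorIso⇒ColourIsoOn (f , f-injective , f∈ , f-onto , f-colour , f-edge) = record
    { embed = f
    ; injective = λ _ _ _ _ → f-injective
    ; embed∈ = λ u _ → f∈ u
    ; onto = λ x Vx → let u , fu≡x = f-onto x Vx in u , refl , fu≡x
    ; preserves-colour = λ u _ → f-colour u
    ; preserves-edge = λ u v _ _ → f-edge u v
    }

  ColourIsoOn⇒ColorIso : ∀ {G} → ColourIsoOn whole G → ColorIso c G ET cT
  ColourIsoOn⇒ColorIso iso =
    embed , injective _ _ refl refl , (λ u → embed∈ u refl) ,
    (λ x Vx → let u , _ , fu≡x = onto x Vx in u , fu≡x) ,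
    (λ u → preserves-colour u refl) , (λ u v → preserves-edge u v refl refl)
    where open ColourIsoOn iso

  module _ {S : Fin m → Bool} {H : Graph n} (cover : Cover S H) (same : AllSameColor H) where
    open Cover cover

    private
      S-subsingleton : ∀ u v → S u ≡ true → S v ≡ true → u ≡ v
      S-subsingleton = allSameColor⇒subsingleton cover same

    single-sound : ∀ {K} → K ∈ map single (verts H) → Subgraph K H × ColourIsoOn S K
    single-sound K∈ with ∈-map⁻ single K∈
    ... | a , a∈ , refl =
      let Va = ∈-verts⁻ {H} a∈ ; w , Sw , ca = colour∈ a Va in
      ((λ x x=a → subst (λ y → V H y ≡ true) (sym (==⇒≡ x=a)) Va) ,
       (λ _ _ ()) , (λ _ _ ()) , (λ _ _ → refl)) ,
      record
        { embed = λ _ → a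
        ; injective = λ u v Su Sv _ → S-subsingleton u v Su Sv
        ; embed∈ = λ _ _ → ==-refl a
        ; onto = λ x x=a → w , Sw , sym (==⇒≡ x=a)
        ; preserves-colour = λ u Su → trans ca (cong cT (S-subsingleton w u Sw Su))
        ; preserves-edge = λ u v Su Sv →
            trans (sym (ET-irrefl u)) (cong (ET u) (S-subsingleton u v Su Sv))
        }

    single-complete : ∀ {G} → Subgraph G H → ColourIsoOn S G → G ∈G map single (verts H)
    single-complete {G} (V⊆ , _ , ends , _) iso =
      let x , Vx = nonempty ; w , Sw , _ = colour∈ x Vx in
      AnyP.map⁺ (lose (∈-verts⁺ {H} (V⊆ (embed w) (embed∈ w Sw))) (same-single w Sw))
      where
      open ColourIsoOn iso
      only-embed : ∀ w → S w ≡ true → ∀ x → V G x ≡ true → x ≡ embed w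
      only-embed w Sw x Vx =
        let u , Su , ux = onto x Vx in trans (sym ux) (cong embed (S-subsingleton u w Su Sw))
      no-edge : ∀ x y → E G x y ≡ true → ⊥
      no-edge x y exy with ends x y exy
      ... | Vx , Vy with onto x Vx | onto y Vy
      ... | u , Su , refl | v , Sv , refl with S-subsingleton u v Su Sv
      ... | refl =
        contradiction (trans (sym exy) (trans (preserves-edge u u Su Sv) (ET-irrefl u))) λ ()
      same-single : ∀ w → S w ≡ true → SameGraph G (single (embed w))
      same-single w Sw =
        (λ x → true⇔⇒≡ (λ Vx → dec-true (x ≟ embed w) (only-embed w Sw x Vx))
                       (λ x=fw → subst (λ y → V G y ≡ true) (sym (==⇒≡ x=fw)) (embed∈ w Sw))) ,
        (λ x y → ¬-not (no-edge x y))

  module Extension {S : Fin m → Bool} {H : Graph n} (cover : Cover S H) (L : Leaf S)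
                   {G : Graph n} {a b : Fin n}
                   (G⊆H⁻ : Subgraph G (removeColor (cT (Leaf.leaf L)) H))
                   (iso : ColourIsoOn (S without Leaf.leaf L) G)
                   (Va : V H a ≡ true) (ca : c a ≡ cT (Leaf.leaf L))
                   (cb : c b ≡ cT (Leaf.neighbour L)) (eab : E H a b ≡ true) (Vb : V G b ≡ true)
                   where
    open Cover cover
    open Leaf L
    open ColourIsoOn iso

    K : Graph n
    K = addLeaf G a b

    a∉G : V G a ≢ true
    a∉G VGa =
      contradiction (trans (sym (≡⇒≡ᵇ ca)) (not-true⁻ (proj₂ (∧-true⁻ (proj₁ G⊆H⁻ a VGa))))) λ ()

    ≢a : ∀ {x} → V G x ≡ true → x ≢ a
    ≢a VGx refl = a∉G VGx

    S⁻-neighbour : (S without leaf) neighbour ≡ true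
    S⁻-neighbour = without⁺ {S = S} neighbour∈ neighbour≢leaf

    embed-neighbour : embed neighbour ≡ b
    embed-neighbour =
      let u , S⁻u , fu≡b = onto b Vb
          cu≡cn = trans (sym (preserves-colour u S⁻u)) (trans (cong c fu≡b) cb)
      in subst (λ u → embed u ≡ b) (cT-injective cu≡cn) fu≡b

    edge-at-a : ∀ x → E K a x ≡ (x == b)
    edge-at-a x
      rewrite ¬-not {E G a x} (λ eax → a∉G (proj₁ (proj₁ (proj₂ (proj₂ G⊆H⁻)) a x eax)))
            | ==-refl a | dec-false (a ≟ b) (≢a Vb ∘ sym) = ∨-identityʳ (x == b)

    edge-within-G : ∀ {x y} → V G x ≡ true → V G y ≡ true → E K x y ≡ E G x y
    edge-within-G {x} {y} VGx VGy
      rewrite dec-false (x ≟ a) (≢a VGx) | dec-false (y ≟ a) (≢a VGy) | ∧-zeroʳ (x == b) =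
      ∨-identityʳ (E G x y)

    K-symmetric : ∀ x y → E K x y ≡ E K y x
    K-symmetric = addLeaf-symmetric G a b (proj₂ (proj₂ (proj₂ G⊆H⁻)))

    subgraph : Subgraph K H
    subgraph = extended G⊆H⁻
      where
      extended : Subgraph G (removeColor (cT leaf) H) → Subgraph K H
      extended (V⊆ , E⊆ , ends , _) = V⊆K , E⊆K , endsK , K-symmetric
        where
        V⊆K : ∀ x → V K x ≡ true → V H x ≡ true
        V⊆K x VKx with addLeaf-vertex⁻ G a b VKx
        ... | inj₁ VGx = proj₁ (∧-true⁻ (V⊆ x VGx))
        ... | inj₂ refl = Va
        E⊆K : ∀ x y → E K x y ≡ true → E H x y ≡ true
        E⊆K x y exy with addLeaf-edge⁻ G a b exy
        ... | inj₁ eG = proj₁ (∧-true⁻ (E⊆ x y eG))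
        ... | inj₂ (inj₁ (refl , refl)) = eab
        ... | inj₂ (inj₂ (refl , refl)) = trans (symmetric b a) eab
        endsK : ∀ x y → E K x y ≡ true → V K x ≡ true × V K y ≡ true
        endsK x y exy with addLeaf-edge⁻ G a b exy
        ... | inj₁ eG = let Vx , Vy = ends x y eG in ∨-true⁺ˡ _ Vx , ∨-true⁺ˡ _ Vy
        ... | inj₂ (inj₁ (refl , refl)) = ∨-true⁺ʳ _ (==-refl a) , ∨-true⁺ˡ _ Vb
        ... | inj₂ (inj₂ (refl , refl)) = ∨-true⁺ˡ _ Vb , ∨-true⁺ʳ _ (==-refl a)

    extend : Fin m → Fin n
    extend u with u ≟ leaf
    ... | yes _ = a
    ... | no _ = embed u

    extend-cases : ∀ u → (u ≡ leaf × extend u ≡ a) ⊎ (u ≢ leaf × extend u ≡ embed u)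
    extend-cases u with u ≟ leaf
    ... | yes u≡l = inj₁ (u≡l , refl)
    ... | no u≢l = inj₂ (u≢l , refl)

    edge-to-leaf : ∀ v → S v ≡ true → v ≢ leaf → E K a (embed v) ≡ ET leaf v
    edge-to-leaf v Sv v≢l = trans (edge-at-a (embed v)) (true⇔⇒≡ to from)
      where
      to : (embed v == b) ≡ true → ET leaf v ≡ true
      to fv=b = subst (λ u → ET leaf u ≡ true)
                      (injective neighbour v S⁻-neighbour (without⁺ {S = S} Sv v≢l)
                                 (trans embed-neighbour (sym (==⇒≡ fv=b))))
                      leaf-adjacent
      from : ET leaf v ≡ true → (embed v == b) ≡ true
      from elv = dec-true (embed v ≟ b)
                          (trans (cong embed (unique-neighbour v Sv elv)) embed-neighbour)

    iso-extended : ColourIsoOn S K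
    iso-extended = record
      { embed = extend
      ; injective = injective⁺
      ; embed∈ = embed∈⁺
      ; onto = onto⁺
      ; preserves-colour = preserves-colour⁺
      ; preserves-edge = preserves-edge⁺
      }
      where
      S⁻ : ∀ {u} → S u ≡ true → u ≢ leaf → (S without leaf) u ≡ true
      S⁻ = without⁺ {S = S}
      injective⁺ : ∀ u v → S u ≡ true → S v ≡ true → extend u ≡ extend v → u ≡ v
      injective⁺ u v Su Sv eq with extend-cases u | extend-cases v
      ... | inj₁ (u≡l , _) | inj₁ (v≡l , _) = trans u≡l (sym v≡l)
      ... | inj₁ (_ , eu) | inj₂ (v≢l , ev) =
        contradiction (trans (sym ev) (trans (sym eq) eu)) (≢a (embed∈ v (S⁻ Sv v≢l)))
      ... | inj₂ (u≢l , eu) | inj₁ (_ , ev) =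
        contradiction (trans (sym eu) (trans eq ev)) (≢a (embed∈ u (S⁻ Su u≢l)))
      ... | inj₂ (u≢l , eu) | inj₂ (v≢l , ev) =
        injective u v (S⁻ Su u≢l) (S⁻ Sv v≢l) (trans (sym eu) (trans eq ev))
      embed∈⁺ : ∀ u → S u ≡ true → V K (extend u) ≡ true
      embed∈⁺ u Su with extend-cases u
      ... | inj₁ (_ , eu) rewrite eu = ∨-true⁺ʳ (V G a) (==-refl a)
      ... | inj₂ (u≢l , eu) rewrite eu = ∨-true⁺ˡ _ (embed∈ u (S⁻ Su u≢l))
      onto⁺ : ∀ x → V K x ≡ true → ∃ λ u → S u ≡ true × extend u ≡ x
      onto⁺ x VKx with addLeaf-vertex⁻ G a b VKx
      ... | inj₂ refl with extend-cases leaf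
      ...   | inj₁ (_ , el) = leaf , leaf∈ , el
      ...   | inj₂ (l≢l , _) = contradiction refl l≢l
      onto⁺ x VKx | inj₁ VGx with onto x VGx
      ... | u , S⁻u , ux with without⁻ {S = S} S⁻u | extend-cases u
      ...   | _ , u≢l | inj₁ (u≡l , _) = contradiction u≡l u≢l
      ...   | Su , _ | inj₂ (_ , eu) = u , Su , trans eu ux
      preserves-colour⁺ : ∀ u → S u ≡ true → c (extend u) ≡ cT u
      preserves-colour⁺ u Su with extend-cases u
      ... | inj₁ (refl , eu) rewrite eu = ca
      ... | inj₂ (u≢l , eu) rewrite eu = preserves-colour u (S⁻ Su u≢l)
      preserves-edge⁺ : ∀ u v → S u ≡ true → S v ≡ true → E K (extend u) (extend v) ≡ ET u v
      preserves-edge⁺ u v Su Sv with extend-cases u | extend-cases v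
      ... | inj₁ (refl , eu) | inj₁ (refl , _) rewrite eu =
        trans (edge-at-a a) (trans (dec-false (a ≟ b) (≢a Vb ∘ sym)) (sym (ET-irrefl leaf)))
      ... | inj₁ (refl , eu) | inj₂ (v≢l , ev) rewrite eu | ev = edge-to-leaf v Sv v≢l
      ... | inj₂ (u≢l , eu) | inj₁ (refl , ev) rewrite eu | ev =
        trans (K-symmetric (embed u) a) (trans (edge-to-leaf u Su u≢l) (ET-sym leaf u))
      ... | inj₂ (u≢l , eu) | inj₂ (v≢l , ev) rewrite eu | ev =
        trans (edge-within-G (embed∈ u (S⁻ Su u≢l)) (embed∈ v (S⁻ Sv v≢l)))
              (preserves-edge u v (S⁻ Su u≢l) (S⁻ Sv v≢l))

  module Restriction {S : Fin m → Bool} {H : Graph n} (L : Leaf S) {G : Graph n}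
                     (G⊆H : Subgraph G H) (iso : ColourIsoOn S G) where
    open Leaf L
    open ColourIsoOn iso

    a b : Fin n
    a = embed leaf
    b = embed neighbour

    G⁻ : Graph n
    G⁻ = removeColor (cT leaf) G

    subgraph⁻ : Subgraph G⁻ (removeColor (cT leaf) H)
    subgraph⁻ = removeColor-mono (cT leaf) G⊆H

    private
      kept : ∀ u → S u ≡ true → u ≢ leaf → not (c (embed u) ℕ.≡ᵇ cT leaf) ≡ true
      kept u Su u≢l = not-true⁺ (other-vertex⇒other-colour (preserves-colour u Su) u≢l)

      G-sym : ∀ x y → E G x y ≡ E G y x
      G-sym = proj₂ (proj₂ (proj₂ G⊆H))

      eab : E G a b ≡ true
      eab = trans (preserves-edge leaf neighbour leaf∈ neighbour∈) leaf-adjacent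

    iso⁻ : ColourIsoOn (S without leaf) G⁻
    iso⁻ = record
      { embed = embed
      ; injective = λ u v S⁻u S⁻v → injective u v (S-of S⁻u) (S-of S⁻v)
      ; embed∈ = λ u S⁻u →
          let Su , u≢l = without⁻ {S = S} S⁻u in ∧-true⁺ (embed∈ u Su) (kept u Su u≢l)
      ; onto = onto⁻
      ; preserves-colour = λ u S⁻u → preserves-colour u (S-of S⁻u)
      ; preserves-edge = preserves-edge⁻
      }
      where
      S-of : ∀ {u} → (S without leaf) u ≡ true → S u ≡ true
      S-of = proj₁ ∘ without⁻ {S = S}
      onto⁻ : ∀ x → V G⁻ x ≡ true → ∃ λ u → (S without leaf) u ≡ true × embed u ≡ x
      onto⁻ x V⁻x with ∧-true⁻ V⁻x
      ... | Vx , ¬αx with onto x Vx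
      ... | u , Su , refl =
        u , without⁺ {S = S} Su (other-colour⇒other-vertex ¬αx (preserves-colour u Su)) , refl
      preserves-edge⁻ : ∀ u v → (S without leaf) u ≡ true → (S without leaf) v ≡ true →
                        E G⁻ (embed u) (embed v) ≡ ET u v
      preserves-edge⁻ u v S⁻u S⁻v =
        let Su , u≢l = without⁻ {S = S} S⁻u ; Sv , v≢l = without⁻ {S = S} S⁻v in
        trans (cong (E G (embed u) (embed v) ∧_) (∧-true⁺ (kept u Su u≢l) (kept v Sv v≢l)))
              (trans (∧-identityʳ _) (preserves-edge u v Su Sv))

    a∈classOf : a ∈ classOf (cT leaf) H
    a∈classOf = ∈-classOf⁺ {H = H} (proj₁ G⊆H a (embed∈ leaf leaf∈)) (preserves-colour leaf leaf∈)

    module _ {G̃ : Graph n} (G⁻≈G̃ : SameGraph G⁻ G̃) where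
      private
        V≗ : ∀ x → V G⁻ x ≡ V G̃ x
        V≗ = proj₁ G⁻≈G̃

        E≗ : ∀ x y → E G⁻ x y ≡ E G̃ x y
        E≗ = proj₂ G⁻≈G̃

      b∈candidates : b ∈ candidates H (cT neighbour) a G̃
      b∈candidates =
        ∈-candidates⁺ {H} {G = G̃} (preserves-colour neighbour neighbour∈)
          (proj₁ (proj₂ G⊆H) a b eab)
          (trans (sym (V≗ b)) (∧-true⁺ (embed∈ neighbour neighbour∈)
                                       (kept neighbour neighbour∈ neighbour≢leaf)))

      same-as-addLeaf : SameGraph G (addLeaf G̃ a b)
      same-as-addLeaf =
        (λ x → true⇔⇒≡ (V-to x) (V-from x)) , (λ x y → true⇔⇒≡ (E-to x y) (E-from x y))
        where
        V-to : ∀ x → V G x ≡ true → V (addLeaf G̃ a b) x ≡ true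
        V-to x Vx with onto x Vx
        ... | u , Su , refl with u ≟ leaf
        ...   | yes refl = ∨-true⁺ʳ (V G̃ a) (==-refl a)
        ...   | no u≢l = ∨-true⁺ˡ _ (trans (sym (V≗ (embed u))) (∧-true⁺ Vx (kept u Su u≢l)))
        V-from : ∀ x → V (addLeaf G̃ a b) x ≡ true → V G x ≡ true
        V-from x VKx with addLeaf-vertex⁻ G̃ a b VKx
        ... | inj₁ VG̃x = proj₁ (∧-true⁻ (trans (V≗ x) VG̃x))
        ... | inj₂ refl = embed∈ leaf leaf∈
        to-neighbour : ∀ v → S v ≡ true → E G a (embed v) ≡ true → v ≡ neighbour
        to-neighbour v Sv eav =
          unique-neighbour v Sv (trans (sym (preserves-edge leaf v leaf∈ Sv)) eav)
        E-to : ∀ x y → E G x y ≡ true → E (addLeaf G̃ a b) x y ≡ true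
        E-to x y exy with proj₁ (proj₂ (proj₂ G⊆H)) x y exy
        ... | Vx , Vy with onto x Vx | onto y Vy
        ... | u , Su , refl | v , Sv , refl with u ≟ leaf | v ≟ leaf
        ...   | yes refl | _ rewrite to-neighbour v Sv exy = addLeaf-edge-ab G̃ a b
        ...   | no u≢l | yes refl rewrite to-neighbour u Su (trans (G-sym a (embed u)) exy) =
          addLeaf-edge-ba G̃ a b
        ...   | no u≢l | no v≢l =
          ∨-true⁺ˡ _ (trans (sym (E≗ (embed u) (embed v)))
                            (∧-true⁺ exy (∧-true⁺ (kept u Su u≢l) (kept v Sv v≢l))))
        E-from : ∀ x y → E (addLeaf G̃ a b) x y ≡ true → E G x y ≡ true
        E-from x y exy with addLeaf-edge⁻ G̃ a b exy
        ... | inj₁ eG̃ = proj₁ (∧-true⁻ (trans (E≗ x y) eG̃))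
        ... | inj₂ (inj₁ (refl , refl)) = eab
        ... | inj₂ (inj₂ (refl , refl)) = trans (G-sym b a) eab

  sound : ∀ {H 𝒢} → AllColorful H 𝒢 → ∀ {S} → Cover S H → ∀ {K} → K ∈ 𝒢 →
          Subgraph K H × ColourIsoOn S K
  sound (base same) cover K∈ = single-sound cover same K∈
  sound {H} (rec {ℋ = ℋ} α β mixed has-α α-β run) cover K∈
    with admissible⇒leaf cover α β mixed has-α α-β
  ... | L , refl , refl with ∈-combine⁻ {H} {ℋ = ℋ} K∈
  ... | a , G , b , a∈ , G∈ , b∈ , refl =
    let Va , ca = ∈-classOf⁻ {H = H} a∈
        cb , eab , Vb = ∈-candidates⁻ {H} {cT (Leaf.neighbour L)} {G = G} b∈
        G⊆H⁻ , isoG = sound run (cover-without-leaf cover L) G∈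
        open Extension cover L G⊆H⁻ isoG Va ca cb eab Vb
    in subgraph , iso-extended

  complete : ∀ {H 𝒢} → AllColorful H 𝒢 → ∀ {S} → Cover S H → ∀ {G} → Subgraph G H →
             ColourIsoOn S G → G ∈G 𝒢
  complete (base same) cover = single-complete cover same
  complete (rec α β mixed has-α α-β run) cover G⊆H iso
    with admissible⇒leaf cover α β mixed has-α α-β
  ... | L , refl , refl =
    let open Restriction L G⊆H iso
        G̃ , G̃∈ , G⁻≈G̃ = find (complete run (cover-without-leaf cover L) subgraph⁻ iso⁻)
    in Any-combine⁺ a∈classOf G̃∈ (b∈candidates G⁻≈G̃) (same-as-addLeaf G⁻≈G̃)

  run-exists : Acyclic ET → ∀ k {S H} → count S ≡ k → Cover S H → ∃ (AllColorful H)
  run-exists acyclic k {S} S≡k cover with Cover.nonempty cover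
  ... | x , Vx with Cover.colour∈ cover x Vx
  ... | w , Sw , _ with subsingleton-or-other S w
  ... | inj₁ only-w = _ , base (subsingleton⇒allSameColor cover w only-w)
  ... | inj₂ (u , Su , u≢w) with leaf-exists acyclic (Cover.connected cover) Sw Su (u≢w ∘ sym)
  ... | L with k | trans (sym (count-without S (Leaf.leaf L) (Leaf.leaf∈ L))) S≡k
  ...   | suc k' | S⁻≡k' =
    _ , rec (cT leaf) (cT neighbour)
          (λ same → neighbour≢leaf
                      (allSameColor⇒subsingleton cover same neighbour leaf neighbour∈ leaf∈))
          (colour-realised cover leaf leaf∈)
          (leaf-colour-admissible cover L)
          (proj₂ (run-exists acyclic k' (ℕ.suc-injective S⁻≡k') (cover-without-leaf cover L)))
    where open Leaf L

module McgCover {n m : ℕ} (EG : Fin n → Fin n → Bool) (c : Fin n → ℕ)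
                (ET : Fin m → Fin m → Bool) (cT : Fin m → ℕ)
                (EG-sym : ∀ x y → EG x y ≡ EG y x) (ET-sym : ∀ x y → ET x y ≡ ET y x) where
  open MCG EG c ET cT

  H₀-edge⁻ : ∀ x y → E H₀ x y ≡ true →
             V H₀ x ≡ true × V H₀ y ≡ true ×
             ∃₂ λ u v → ET u v ≡ true × c x ≡ cT u × c y ≡ cT v
  H₀-edge⁻ x y exy =
    let _ , rest = ∧-true⁻ {EG x y} exy ; Vx , rest = ∧-true⁻ rest
        Vy , coloured = ∧-true⁻ rest ; u , coloured = anyF⁻ coloured ; v , coloured = anyF⁻ coloured
        euv , colours = ∧-true⁻ coloured ; cx , cy = ∧-true⁻ colours
    in Vx , Vy , u , v , euv , ≡ᵇ⇒≡ cx , ≡ᵇ⇒≡ cy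

  H₀-edge-flip : ∀ x y → E H₀ x y ≡ true → E H₀ y x ≡ true
  H₀-edge-flip x y exy =
    let Vx , Vy , u , v , euv , cx , cy = H₀-edge⁻ x y exy in
    ∧-true⁺ (trans (EG-sym y x) (proj₁ (∧-true⁻ {EG x y} exy))) (∧-true⁺ Vy (∧-true⁺ Vx
      (anyF⁺ v (anyF⁺ u (∧-true⁺ (trans (ET-sym v u) euv) (∧-true⁺ (≡⇒≡ᵇ cy) (≡⇒≡ᵇ cx)))))))

  H₀-subgraph : Subgraph H₀ H₀
  H₀-subgraph =
    (λ _ Vx → Vx) , (λ _ _ exy → exy) ,
    (λ x y exy → let Vx , Vy , _ = H₀-edge⁻ x y exy in Vx , Vy) ,
    (λ x y → true⇔⇒≡ (H₀-edge-flip x y) (H₀-edge-flip y x))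

  deleteV-subgraph : ∀ {H K} v → Subgraph H K → Subgraph (deleteV H v) K
  deleteV-subgraph v (V⊆ , E⊆ , ends , H-sym) =
    (λ x V'x → V⊆ x (proj₁ (∧-true⁻ V'x))) ,
    (λ x y e'xy → E⊆ x y (proj₁ (∧-true⁻ e'xy))) ,
    (λ x y e'xy →
      let exy , kept = ∧-true⁻ e'xy ; x≠v , y≠v = ∧-true⁻ kept ; Vx , Vy = ends x y exy
      in ∧-true⁺ Vx x≠v , ∧-true⁺ Vy y≠v) ,
    (λ x y → cong₂ _∧_ (H-sym x y) (∧-comm (not (x == v)) _))

  loop-subgraph : ∀ k H → Subgraph H H₀ → Subgraph (loop k H) H₀
  loop-subgraph zero H H⊆H₀ = H⊆H₀
  loop-subgraph (suc k) H H⊆H₀ with findF (bad H)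
  ... | nothing = H⊆H₀
  ... | just v = loop-subgraph k (deleteV H v) (deleteV-subgraph v H⊆H₀)

  -- each iteration that does not stop deletes one of the at most k vertices
  loop-no-bad : ∀ k H → count (V H) ≤ k → ∀ x → bad (loop (suc k) H) x ≡ false
  loop-no-bad k H VH≤k x with findF (bad H) in found
  ... | nothing = findF-nothing (bad H) found x
  ... | just v with count-without (V H) v (proj₁ (∧-true⁻ {V H v} (findF-just (bad H) found)))
  loop-no-bad zero H VH≤0 x | just v | VH≡ = contradiction (subst (_≤ 0) VH≡ VH≤0) λ ()
  loop-no-bad (suc k) H VH≤k x | just v | VH≡ =
    loop-no-bad k (deleteV H v) (≤-pred (subst (_≤ suc k) VH≡ VH≤k)) x

  mcg-subgraph : Subgraph mcg H₀
  mcg-subgraph = loop-subgraph (suc n) H₀ H₀-subgraph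

  mcg-no-bad : ∀ x → bad mcg x ≡ false
  mcg-no-bad = loop-no-bad n H₀ (count-≤ (V H₀))

  module _ (ET-irrefl : ∀ x → ET x x ≡ false) (cT-injective : Injective _≡_ _≡_ cT)
           (connected : Connected ET) where
    open Subtrees ET ET-sym ET-irrefl
    open Covers c ET cT ET-sym ET-irrefl cT-injective

    mcg-cover : (∃ λ x → V mcg x ≡ true) → Cover whole mcg
    mcg-cover nonempty = record
      { colour∈ = λ x Vx → let w , cx = anyF⁻ (proj₁ mcg-subgraph x Vx) in w , refl , ≡ᵇ⇒≡ cx
      ; edge∈ = edge∈
      ; lift = lift
      ; symmetric = proj₂ (proj₂ (proj₂ mcg-subgraph))
      ; nonempty = nonempty
      ; connected = connected⇒connectedIn-whole connected
      }
      where
      edge∈ : ∀ x y → E mcg x y ≡ true → V mcg x ≡ true × V mcg y ≡ true ×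
              ∃₂ λ u v → true ≡ true × true ≡ true × ET u v ≡ true × c x ≡ cT u × c y ≡ cT v
      edge∈ x y exy =
        let Vx , Vy = proj₁ (proj₂ (proj₂ mcg-subgraph)) x y exy
            _ , _ , u , v , euv , cx , cy = H₀-edge⁻ x y (proj₁ (proj₂ mcg-subgraph) x y exy)
        in Vx , Vy , u , v , refl , refl , euv , cx , cy
      lift : ∀ x w w' → V mcg x ≡ true → c x ≡ cT w → true ≡ true → true ≡ true →
             ET w w' ≡ true → ∃ λ y → E mcg x y ≡ true × c y ≡ cT w'
      lift x w w' Vx cx _ _ eww' with anyF (λ y → E mcg x y ∧ (c y ℕ.≡ᵇ cT w')) in lifted
      ... | true =
        let y , found = anyF⁻ lifted ; exy , cy = ∧-true⁻ {E mcg x y} found in y , exy , ≡ᵇ⇒≡ cy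
      ... | false = contradiction (trans (sym (mcg-no-bad x)) x-bad) λ ()
        where
        x-bad : bad mcg x ≡ true
        x-bad =
          ∧-true⁺ Vx (anyF⁺ w (anyF⁺ w' (∧-true⁺ (≡⇒≡ᵇ cx) (∧-true⁺ eww' (not-true⁺ lifted)))))

theorem9 : ∀ {n m : ℕ} (EG : Fin n → Fin n → Bool) (c : Fin n → ℕ)
           (ET : Fin m → Fin m → Bool) (cT : Fin m → ℕ) →
           IsSimpleAdj EG →
           IsTree ET →
           Injective _≡_ _≡_ cT →
           (∃ λ v → V (MCG.mcg EG c ET cT) v ≡ true) →
           (∃ λ 𝒢 → AllColorfulAlg.AllColorful c (MCG.mcg EG c ET cT) 𝒢) ×
           (∀ 𝒢 → AllColorfulAlg.AllColorful c (MCG.mcg EG c ET cT) 𝒢 →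
             ∀ (G' : Graph n) → Subgraph G' (MCG.mcg EG c ET cT) →
             (G' ∈G 𝒢) ⇔ ColorIso c G' ET cT)
theorem9 EG c ET cT (EG-sym , _) ((ET-sym , ET-irrefl) , _ , connected , acyclic) cT-injective
         nonempty =
  run-exists acyclic _ refl cover ,
  λ 𝒢 run G' G'⊆H → mk⇔
    (λ G'∈ → let K , K∈ , G'≈K = find G'∈ in
             ColourIsoOn⇒ColorIso (ColourIsoOn-resp G'≈K (proj₂ (sound run cover K∈))))
    (complete run cover G'⊆H ∘ ColorIso⇒ColourIsoOn)
  where
  open Subtrees ET ET-sym ET-irrefl using (whole)
  open Covers c ET cT ET-sym ET-irrefl cT-injective
  cover : Cover whole (MCG.mcg EG c ET cT)
  cover = McgCover.mcg-cover EG c ET cT EG-sym ET-sym ET-irrefl cT-injective connected nonempty
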